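{- Work in the class language $LL$ with the axioms of extensionality and impredicative comprehension. Let $F$ be an injective class function from the universe $V$ of all sets to $V$. Then $F$ is productive on the class $I=\{F(x)\mid x \text{ a set},\ F(x)\notin x\}$ (i.e. for every set $s\subseteq I$, $F(s)\in I\setminus s$), and consequently $I$ is a paradoxical class.
   Context: In $LL$ objects are classes; a class is a set iff it is an element of some class, otherwise it is a paradoxical (proper) class; lower-case variables range over sets. -}

module Defs where

open import Level using (Level; _⊔_; suc)
open import Data.Product using (Σ; _×_)
open import Relation.Binary.PropositionalEquality using (_≡_)
open import Relation.Nullary using (¬_)

_↔_ : ∀ {a b} → Set a → Set b → Set (a ⊔ b)
A ↔ B = (A → B) × (B → A)

record LL (a ℓ : Level) : Set (suc (a ⊔ ℓ)) where
  field
    Class : Set a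
    _∈_   : Class → Class → Set ℓ

  IsSet : Class → Set (a ⊔ ℓ)
  IsSet x = Σ Class (λ y → x ∈ y)

  Paradoxical : Class → Set (a ⊔ ℓ)
  Paradoxical x = ¬ IsSet x

  _∉_ : Class → Class → Set ℓ
  x ∉ y = ¬ (x ∈ y)

  field
    extensionality : ∀ x y → (∀ z → (z ∈ x) ↔ (z ∈ y)) → x ≡ y
    -- impredicative comprehension: for every (arbitrary, possibly
    -- class-quantifying) property φ there is a class of all sets satisfying φ
    comprehension : (φ : Class → Set (a ⊔ ℓ)) →
      Σ Class (λ A → ∀ z → (z ∈ A) ↔ (IsSet z × φ z))

  _⊆_ : Class → Class → Set (a ⊔ ℓ)
  s ⊆ X = ∀ z → z ∈ s → z ∈ X

  -- a class function V → V (given as an operation on classes, only its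
  -- behaviour on sets matters)
  IsClassFunctionVV : (Class → Class) → Set (a ⊔ ℓ)
  IsClassFunctionVV F = ∀ x → IsSet x → IsSet (F x)

  InjectiveOnV : (Class → Class) → Set (a ⊔ ℓ)
  InjectiveOnV F = ∀ x y → IsSet x → IsSet y → F x ≡ F y → x ≡ y

  ProductiveOn : (Class → Class) → Class → Set (a ⊔ ℓ)
  ProductiveOn F X = ∀ s → IsSet s → s ⊆ X → (F s ∈ X) × (F s ∉ s)

{-# OPTIONS --safe #-}
module Submission where

-- A Russell-style diagonal argument. If a set s ⊆ I contained F(s), then F(s) = F(x) for
-- some set x with F(x) ∉ x, and injectivity gives s = x, so F(s) ∉ s after all. Hence
-- F(s) ∉ s, which is precisely the condition for F(s) ∈ I. If I were a set, applying this
-- to s = I would give F(I) ∈ I and F(I) ∉ I.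

open import Defs
open import Level using (Level)
open import Data.Product using (Σ; _×_; _,_; proj₁; proj₂)
open import Relation.Binary.PropositionalEquality using (_≡_; refl; subst)

module _ {a ℓ : Level} (M : LL a ℓ) where
  open LL M

  productive⇒paradoxical : ∀ {F X} → ProductiveOn F X → Paradoxical X
  productive⇒paradoxical {X = X} productive X-isSet =
    let F[X]∈X , F[X]∉X = productive X X-isSet (λ _ z∈X → z∈X) in F[X]∉X F[X]∈X

  module _ {F : Class → Class} (injective : InjectiveOnV F) {I : Class}
           (I-def : ∀ z → (z ∈ I) ↔ Σ Class (λ x → IsSet x × (z ≡ F x) × (F x ∉ x)))
           where

    image∉ : ∀ s → IsSet s → s ⊆ I → F s ∉ s
    image∉ s s-isSet s⊆I F[s]∈s with proj₁ (I-def (F s)) (s⊆I (F s) F[s]∈s)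
    ... | x , x-isSet , F[s]≡F[x] , F[x]∉x =
      F[x]∉x (subst (λ y → F y ∈ y) (injective s x s-isSet x-isSet F[s]≡F[x]) F[s]∈s)

    productiveOn-I : ProductiveOn F I
    productiveOn-I s s-isSet s⊆I =
      proj₂ (I-def (F s)) (s , s-isSet , refl , F[s]∉s) , F[s]∉s
      where F[s]∉s = image∉ s s-isSet s⊆I

mainTheorem6 : ∀ {a ℓ : Level} (M : LL a ℓ) → let open LL M in
    (F : Class → Class) → IsClassFunctionVV F → InjectiveOnV F →
    (I : Class) →
    (∀ z → (z ∈ I) ↔ Σ Class (λ x → IsSet x × (z ≡ F x) × (F x ∉ x))) →
    ProductiveOn F I × Paradoxical I
mainTheorem6 M F _ injective I I-def =
  productive , productive⇒paradoxical M productive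
  where productive = productiveOn-I M injective I-def
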